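{- Let $D$ be a $\langle 2,2\rangle$ digraph and $G=CCE(D)$. Let $P_{u,\ell}=u_1u_2\cdots u_\ell$ and $P_{v,m}=v_1v_2\cdots v_m$ be nontrivial paths in $G$ with $\ell\ge 3$. Suppose that $(u_1,v_t)$, $(u_2,v_t)$ and $(u_2,v_{t+1})$ are arcs of $D$ for some integer $t\in\{1,\ldots,m-1\}$. Then $u^+_{i,i+1}=v_{t+i-1}$ for each integer $i$ with $1\le i\le \min(\ell-1,\,m-t+1)$.
   Context: All graphs and digraphs are simple (no loops, no multiple arcs). In a digraph $D$, if $(u,x)$ is an arc then $x$ is a prey of $u$ and $u$ is a predator of $x$. The CCE graph $CCE(D)$ of $D$ is the graph on $V(D)$ in which distinct $u,v$ are adjacent iff they have a common prey and a common predator in $D$. A $\langle 2,2\rangle$ digraph is a digraph in which every vertex has indegree at most $2$ and outdegree at most $2$. In this setting, for a path $u_1\cdots u_\ell$ in $G$ with $\ell\ge 3$ and $1\le i\le \ell-1$, the vertices $u_i,u_{i+1}$ have exactly one common prey and exactly one common predator in $D$; these are denoted $u^+_{i,i+1}$ and $u^-_{i,i+1}$ respectively. -}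

module Defs where

open import Data.Nat using (ℕ; zero; suc; _+_; _∸_; _≤_; _<_; _⊓_)
open import Data.Fin using (Fin)
open import Data.Bool using (Bool; true; false; T; if_then_else_)
open import Data.List using (List; map; allFin)
open import Data.Nat.ListAction using (sum)
open import Data.Product using (Σ; _×_; ∃; ∃-syntax)
open import Relation.Binary.PropositionalEquality using (_≡_)
open import Relation.Nullary using (¬_)

record Digraph (n : ℕ) : Set where
  field
    arcB     : Fin n → Fin n → Bool
    loopless : ∀ v → arcB v v ≡ false

module _ {n : ℕ} (D : Digraph n) where
  open Digraph D

  -- (u , x) is an arc: x is a prey of u, u is a predator of x
  Arc : Fin n → Fin n → Set
  Arc u x = T (arcB u x)

  outdeg : Fin n → ℕ
  outdeg u = sum (map (λ x → if arcB u x then 1 else 0) (allFin n))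

  indeg : Fin n → ℕ
  indeg x = sum (map (λ u → if arcB u x then 1 else 0) (allFin n))

  Is22 : Set
  Is22 = ∀ v → indeg v ≤ 2 × outdeg v ≤ 2

  CommonPrey : Fin n → Fin n → Fin n → Set
  CommonPrey u v x = Arc u x × Arc v x

  CommonPredator : Fin n → Fin n → Fin n → Set
  CommonPredator u v y = Arc y u × Arc y v

  CCEAdj : Fin n → Fin n → Set
  CCEAdj u v = ¬ (u ≡ v) × (∃[ x ] CommonPrey u v x) × (∃[ y ] CommonPredator u v y)

  -- A path u_1 ⋯ u_ℓ in CCE(D), vertices indexed 1..ℓ by a function ℕ → Fin n
  -- (values outside 1..ℓ are irrelevant): distinct vertices, consecutive ones adjacent.
  IsPath : (ℓ : ℕ) → (ℕ → Fin n) → Set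
  IsPath ℓ u =
    (∀ i j → 1 ≤ i → i ≤ ℓ → 1 ≤ j → j ≤ ℓ → u i ≡ u j → i ≡ j) ×
    (∀ i → 1 ≤ i → i < ℓ → CCEAdj (u i) (u (suc i)))

  IsTheCommonPrey : Fin n → Fin n → Fin n → Set
  IsTheCommonPrey u v w = CommonPrey u v w × (∀ x → CommonPrey u v x → x ≡ w)

-- Every vertex of a ⟨2,2⟩ digraph has at most two prey and at most two predators, so once
-- u_{k+1}, u_{k+2} both prey on v_{k+t} and u_{k+2} preys on v_{k+t+1}, the common prey of
-- u_{k+2}, u_{k+3} can only be v_{k+t+1} (v_{k+t} would get three predators), and dually the
-- common predator of v_{k+t+1}, v_{k+t+2} can only be u_{k+3}. This zigzag propagates along
-- both paths; uniqueness of the common prey again follows by counting prey and predators of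
-- the neighbour u_k (or u_3 when k = 0).
module Submission where

open import Defs
open import Data.Nat using (ℕ; zero; suc; _+_; _∸_; _≤_; _<_; _⊓_; z≤n; s≤s; s≤s⁻¹)
open import Data.Nat.Properties
  using (≤-refl; ≤-trans; <⇒≤; <⇒≢; n≤1+n; n<1+n; m<n⇒m<1+n; m≤n+m; +-suc; +-comm;
         m⊓n≤m; m⊓n≤n; m∸n≤m; m≤o∸n⇒m+n≤o)
open import Data.Fin using (Fin; zero; suc; _≟_)
open import Data.Bool using (Bool; true; false; T; if_then_else_)
open import Data.List using (map; allFin; tabulate)
open import Data.List.Properties using (map-tabulate)
open import Data.Nat.ListAction using (sum)
open import Data.Product using (_×_; _,_; ∃; proj₁; proj₂; swap; map₂)
open import Data.Sum using (_⊎_; inj₁; inj₂)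
open import Data.Empty using (⊥; ⊥-elim)
open import Relation.Binary.PropositionalEquality using (_≡_; _≢_; ≢-sym; refl; sym; cong; subst)
open import Relation.Nullary using (yes; no)
open import Function using (_∘_)

count : ∀ {k} → (Fin k → Bool) → ℕ
count f = sum (tabulate (λ x → if f x then 1 else 0))

sum-indicator≡count : ∀ {k} (f : Fin k → Bool) →
  sum (map (λ x → if f x then 1 else 0) (allFin k)) ≡ count f
sum-indicator≡count f = cong sum (map-tabulate (λ x → x) (λ x → if f x then 1 else 0))

count-≥1 : ∀ {k} (f : Fin k → Bool) {a} → T (f a) → 1 ≤ count f
count-≥1 f {zero} fa with f zero
... | true  = s≤s z≤n
... | false = ⊥-elim fa
count-≥1 f {suc a} fa = ≤-trans (count-≥1 (f ∘ suc) fa) (m≤n+m _ _)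

count-≥2 : ∀ {k} (f : Fin k → Bool) {a b} → a ≢ b → T (f a) → T (f b) → 2 ≤ count f
count-≥2 f {zero} {zero} a≢b _ _ = ⊥-elim (a≢b refl)
count-≥2 f {zero} {suc b} _ fa fb with f zero
... | true  = s≤s (count-≥1 (f ∘ suc) fb)
... | false = ⊥-elim fa
count-≥2 f {suc a} {zero} _ fa fb with f zero
... | true  = s≤s (count-≥1 (f ∘ suc) fa)
... | false = ⊥-elim fb
count-≥2 f {suc a} {suc b} a≢b fa fb =
  ≤-trans (count-≥2 (f ∘ suc) (a≢b ∘ cong suc) fa fb) (m≤n+m _ _)

Distinct₃ : {A : Set} → A → A → A → Set
Distinct₃ a b c = a ≢ b × a ≢ c × b ≢ c

Distinct₃-reverse : {A : Set} {a b c : A} → Distinct₃ a b c → Distinct₃ c b a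
Distinct₃-reverse (a≢b , a≢c , b≢c) = ≢-sym b≢c , ≢-sym a≢c , ≢-sym a≢b

count-≥3 : ∀ {k} (f : Fin k → Bool) {a b c} → Distinct₃ a b c →
  T (f a) → T (f b) → T (f c) → 3 ≤ count f
count-≥3 f {zero} {zero} (a≢b , _) _ _ _ = ⊥-elim (a≢b refl)
count-≥3 f {zero} {suc b} {zero} (_ , a≢c , _) _ _ _ = ⊥-elim (a≢c refl)
count-≥3 f {suc a} {zero} {zero} (_ , _ , b≢c) _ _ _ = ⊥-elim (b≢c refl)
count-≥3 f {zero} {suc b} {suc c} (_ , _ , b≢c) fa fb fc with f zero
... | true  = s≤s (count-≥2 (f ∘ suc) (b≢c ∘ cong suc) fb fc)
... | false = ⊥-elim fa
count-≥3 f {suc a} {zero} {suc c} (_ , a≢c , _) fa fb fc with f zero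
... | true  = s≤s (count-≥2 (f ∘ suc) (a≢c ∘ cong suc) fa fc)
... | false = ⊥-elim fb
count-≥3 f {suc a} {suc b} {zero} (a≢b , _) fa fb fc with f zero
... | true  = s≤s (count-≥2 (f ∘ suc) (a≢b ∘ cong suc) fa fb)
... | false = ⊥-elim fc
count-≥3 f {suc a} {suc b} {suc c} (a≢b , a≢c , b≢c) fa fb fc =
  ≤-trans (count-≥3 (f ∘ suc) (a≢b ∘ cong suc , a≢c ∘ cong suc , b≢c ∘ cong suc) fa fb fc)
          (m≤n+m _ _)

3≰2 : 3 ≤ 2 → ⊥
3≰2 (s≤s (s≤s ()))

reverse : ∀ {n} → Digraph n → Digraph n
reverse D = record { arcB = λ u v → arcB v u ; loopless = loopless }
  where open Digraph D

Is22-reverse : ∀ {n} (D : Digraph n) → Is22 D → Is22 (reverse D)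
Is22-reverse D is22 = swap ∘ is22

¬three-predators : ∀ {n} (D : Digraph n) → Is22 D → ∀ {a b c x} → Distinct₃ a b c →
  Arc D a x → Arc D b x → Arc D c x → ⊥
¬three-predators D is22 {x = x} abc ax bx cx =
  3≰2 (≤-trans (subst (3 ≤_) (sym (sum-indicator≡count (λ y → arcB y x)))
                      (count-≥3 (λ y → arcB y x) abc ax bx cx))
               (proj₁ (is22 x)))
  where open Digraph D

module _ {n} (D : Digraph n) (is22 : Is22 D) where

  ¬three-prey : ∀ {u x y z} → Distinct₃ x y z →
    Arc D u x → Arc D u y → Arc D u z → ⊥
  ¬three-prey = ¬three-predators (reverse D) (Is22-reverse D is22)

  prey-of-two : ∀ {b x y z} → x ≢ y →
    Arc D b x → Arc D b y → Arc D b z → z ≡ x ⊎ z ≡ y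
  prey-of-two {x = x} {y} {z} x≢y bx by bz with z ≟ x | z ≟ y
  ... | yes z≡x | _       = inj₁ z≡x
  ... | no _    | yes z≡y = inj₂ z≡y
  ... | no z≢x  | no z≢y  = ⊥-elim (¬three-prey (x≢y , ≢-sym z≢x , ≢-sym z≢y) bx by bz)

  next-prey : ∀ {a b c x y} → Distinct₃ a b c → x ≢ y →
    Arc D a x → Arc D b x → Arc D b y → ∃ (CommonPrey D b c) → Arc D c y
  next-prey abc x≢y ax bx by (z , bz , cz) with prey-of-two x≢y bx by bz
  ... | inj₁ refl = ⊥-elim (¬three-predators D is22 abc ax bx cz)
  ... | inj₂ refl = cz

  common-prey-unique : ∀ {a b c w x} → Distinct₃ a b c →
    Arc D a w → Arc D b w → Arc D a x → Arc D b x → ∃ (CommonPrey D b c) → x ≡ w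
  common-prey-unique {w = w} {x = x} abc aw bw ax bx (z , bz , cz) with x ≟ w
  ... | yes x≡w = x≡w
  ... | no x≢w with prey-of-two x≢w bx bw bz
  ...   | inj₁ refl = ⊥-elim (¬three-predators D is22 abc ax bx cz)
  ...   | inj₂ refl = ⊥-elim (¬three-predators D is22 abc aw bw cz)

next-predator : ∀ {n} (D : Digraph n) → Is22 D → ∀ {p q r x y} → Distinct₃ p q r → x ≢ y →
  Arc D x p → Arc D x q → Arc D y q → ∃ (CommonPredator D q r) → Arc D y r
next-predator D is22 = next-prey (reverse D) (Is22-reverse D is22)

module _ {n} (D : Digraph n) {ℓ} {u : ℕ → Fin n} (path : IsPath D ℓ u) where

  path-distinct : ∀ {i j} → 1 ≤ i → i < j → j ≤ ℓ → u i ≢ u j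
  path-distinct {i} {j} 1≤i i<j j≤ℓ ui≡uj =
    <⇒≢ i<j (proj₁ path i j 1≤i (≤-trans (<⇒≤ i<j) j≤ℓ) (≤-trans 1≤i (<⇒≤ i<j)) j≤ℓ ui≡uj)

  path-distinct₃ : ∀ {i} → 1 ≤ i → 2 + i ≤ ℓ → Distinct₃ (u i) (u (1 + i)) (u (2 + i))
  path-distinct₃ {i} 1≤i i+2≤ℓ =
    path-distinct 1≤i (n<1+n i) (≤-trans (n≤1+n _) i+2≤ℓ) ,
    path-distinct 1≤i (m<n⇒m<1+n (n<1+n i)) i+2≤ℓ ,
    path-distinct (s≤s z≤n) (n<1+n (1 + i)) i+2≤ℓ

  path-common-prey : ∀ {i} → 1 ≤ i → i < ℓ → ∃ (CommonPrey D (u i) (u (1 + i)))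
  path-common-prey 1≤i i<ℓ = proj₁ (proj₂ (proj₂ path _ 1≤i i<ℓ))

  path-common-predator : ∀ {i} → 1 ≤ i → i < ℓ → ∃ (CommonPredator D (u i) (u (1 + i)))
  path-common-predator 1≤i i<ℓ = proj₂ (proj₂ (proj₂ path _ 1≤i i<ℓ))

module Zigzag {n} (D : Digraph n) (is22 : Is22 D) {ℓ m} {u v : ℕ → Fin n}
  (u-path : IsPath D ℓ u) (v-path : IsPath D m v) (3≤ℓ : 3 ≤ ℓ) {t} (1≤t : 1 ≤ t)
  (u₁vₜ : Arc D (u 1) (v t)) (u₂vₜ : Arc D (u 2) (v t)) (u₂vₜ₊₁ : Arc D (u 2) (v (1 + t)))
  where

  -- Wedge k is the paper's configuration at i = k + 1: u_i and u_{i+1} both prey on v_{t+i-1}.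
  Wedge : ℕ → Set
  Wedge k = Arc D (u (1 + k)) (v (k + t)) × Arc D (u (2 + k)) (v (k + t))

  Zig : ℕ → Set
  Zig k = Wedge k × Arc D (u (2 + k)) (v (1 + k + t))

  private
    weaken : ∀ {a b} → suc a ≤ b → a ≤ b
    weaken = ≤-trans (n≤1+n _)

    1≤k+t : ∀ k → 1 ≤ k + t
    1≤k+t zero    = 1≤t
    1≤k+t (suc k) = s≤s z≤n

  wedge-step : ∀ k → Zig k → 3 + k ≤ ℓ → 1 + k + t ≤ m → Wedge (1 + k)
  wedge-step k ((a , b) , c) k+3≤ℓ k+t+1≤m =
    c , next-prey D is22 (path-distinct₃ D u-path (s≤s z≤n) k+3≤ℓ)
                       (path-distinct D v-path (1≤k+t k) ≤-refl k+t+1≤m)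
                       a b c (path-common-prey D u-path (s≤s z≤n) k+3≤ℓ)

  zig-step : ∀ k → Zig k → Wedge (1 + k) → 3 + k ≤ ℓ → 2 + k + t ≤ m → Zig (1 + k)
  zig-step k ((_ , b) , c) (c′ , d) k+3≤ℓ k+t+2≤m =
    (c′ , d) , next-predator D is22 (path-distinct₃ D v-path (1≤k+t k) k+t+2≤m)
                                  (path-distinct D u-path (s≤s z≤n) ≤-refl k+3≤ℓ)
                                  b c d (path-common-predator D v-path (s≤s z≤n) k+t+2≤m)

  zig : ∀ k → 2 + k ≤ ℓ → 1 + k + t ≤ m → Zig k
  zig zero    _      _      = (u₁vₜ , u₂vₜ) , u₂vₜ₊₁
  zig (suc k) k+3≤ℓ k+t+2≤m =
    zig-step k z (wedge-step k z k+3≤ℓ (weaken k+t+2≤m)) k+3≤ℓ k+t+2≤m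
    where
    z : Zig k
    z = zig k (weaken k+3≤ℓ) (weaken k+t+2≤m)

  wedge : ∀ k → 2 + k ≤ ℓ → k + t ≤ m → Wedge k
  wedge zero    _      _      = u₁vₜ , u₂vₜ
  wedge (suc k) k+3≤ℓ k+t+1≤m = wedge-step k (zig k (weaken k+3≤ℓ) k+t+1≤m) k+3≤ℓ k+t+1≤m

  the-common-prey : ∀ k → 2 + k ≤ ℓ → k + t ≤ m →
    IsTheCommonPrey D (u (1 + k)) (u (2 + k)) (v (k + t))
  the-common-prey k k+2≤ℓ k+t≤m with wedge k k+2≤ℓ k+t≤m
  ... | a , b = (a , b) , unique k k+2≤ℓ a b
    where
    unique : ∀ k → 2 + k ≤ ℓ → ∀ {w} → Arc D (u (1 + k)) w → Arc D (u (2 + k)) w →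
      ∀ x → CommonPrey D (u (1 + k)) (u (2 + k)) x → x ≡ w
    unique zero _ aw bw x (ax , bx) =
      common-prey-unique D is22 (path-distinct₃ D u-path (s≤s z≤n) 3≤ℓ) aw bw ax bx
                         (path-common-prey D u-path (s≤s z≤n) 3≤ℓ)
    unique (suc k) k+3≤ℓ aw bw x (ax , bx) =
      common-prey-unique D is22 (Distinct₃-reverse (path-distinct₃ D u-path (s≤s z≤n) k+3≤ℓ))
                         bw aw bx ax
                         (map₂ swap (path-common-prey D u-path (s≤s z≤n) (weaken k+3≤ℓ)))

proposition2p4 : {n : ℕ} (D : Digraph n) → Is22 D →
    (ℓ m : ℕ) (u v : ℕ → Fin n) →
    IsPath D ℓ u → IsPath D m v → 3 ≤ ℓ → 2 ≤ m →
    (t : ℕ) → 1 ≤ t → t ≤ m ∸ 1 →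
    Arc D (u 1) (v t) → Arc D (u 2) (v t) → Arc D (u 2) (v (suc t)) →
    ∀ i → 1 ≤ i → i ≤ (ℓ ∸ 1) ⊓ (m ∸ t + 1) →
    IsTheCommonPrey D (u i) (u (suc i)) (v (t + i ∸ 1))
proposition2p4 D is22 (suc ℓ) m u v u-path v-path 3≤ℓ _ t 1≤t t≤m-1 u₁vₜ u₂vₜ u₂vₜ₊₁
  (suc k) _ k+1≤min rewrite +-suc t k | +-comm t k =
  Zigzag.the-common-prey D is22 u-path v-path 3≤ℓ 1≤t u₁vₜ u₂vₜ u₂vₜ₊₁ k
    (s≤s (≤-trans k+1≤min (m⊓n≤m _ _))) k+t≤m
  where
  k≤m∸t : k ≤ m ∸ t
  k≤m∸t = s≤s⁻¹ (subst (suc k ≤_) (+-comm (m ∸ t) 1) (≤-trans k+1≤min (m⊓n≤n _ _)))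

  k+t≤m : k + t ≤ m
  k+t≤m = m≤o∸n⇒m+n≤o k (≤-trans t≤m-1 (m∸n≤m m 1)) k≤m∸t
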